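{- Fix a nonempty set $S\subseteq\mathbb{Z}_{\ge0}$. Let $\mathbf\Omega_{S,\mathbf{LF}}\subseteq\mathbf{LF}$ (resp. $\mathbf\Omega_{S,\mathbf{AF}}\subseteq\mathbf{AF}$) be the set of quivers $Q$ for which there exist vertices $i,j$ with $Q(i,j)\in S$. Then $\mathbf\Omega_{S,\mathbf{LF}}$ is dense and open in $\mathbf{LF}$, and $\mathbf\Omega_{S,\mathbf{AF}}$ is dense and open in $\mathbf{AF}$.
   Context: $\mathbb{N}$ is the positive integers. A quiver on $\mathbb{N}$ is a function $Q:\mathbb{N}\times\mathbb{N}\to\mathbb{Z}$ with $Q(x,y)=-Q(y,x)$; it is locally finite if $\sum_y|Q(x,y)|<\infty$ for each $x$. $\mathbf{AF}$ is the set of all quivers on $\mathbb{N}$ with the topology generated by $U_{Q,V}=\{Q':Q'(x,y)=Q(x,y)\ \forall x,y\in V\}$, $V$ finite. $\mathbf{LF}$ is the set of locally finite quivers with the topology generated by $\{Q'\in\mathbf{LF}:Q'(x,y)=Q(x,y)\text{ whenever }x\in V\text{ or }y\in V\}$, $V$ finite. -}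

module Defs where

open import Data.Nat using (ℕ; zero; suc; _+_; _≤_)
open import Data.Integer as ℤ using (ℤ; +_; ∣_∣)
open import Data.List using (List)
open import Data.List.Membership.Propositional using (_∈_)
open import Data.Product using (Σ; ∃; ∃-syntax; _×_; _,_; proj₁)
open import Data.Sum using (_⊎_)
open import Relation.Binary.PropositionalEquality using (_≡_)

-- Vertices: ℕ = {0,1,2,...} stands for the paper's positive integers
-- (relabelling v ↦ v+1; nothing depends on the names of vertices).

IsQuiver : (ℕ → ℕ → ℤ) → Set
IsQuiver Q = ∀ x y → Q x y ≡ ℤ.- Q y x

Quiver : Set
Quiver = Σ (ℕ → ℕ → ℤ) IsQuiver

partialAbsSum : (ℕ → ℕ → ℤ) → ℕ → ℕ → ℕ
partialAbsSum Q x zero    = 0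
partialAbsSum Q x (suc n) = partialAbsSum Q x n + ∣ Q x n ∣

-- locally finite: Σ_y |Q(x,y)| < ∞ for every x (series of nonnegative
-- terms converges iff its partial sums are bounded)
LocallyFinite : Quiver → Set
LocallyFinite (Q , _) = ∀ x → ∃[ B ] (∀ n → partialAbsSum Q x n ≤ B)

AF : Set
AF = Quiver

LF : Set
LF = Σ Quiver LocallyFinite

-- basic neighbourhoods.  nbhdX P V P' : P' lies in the basic open set
-- determined by P and the finite vertex set V (given as a list).
nbhdAF : AF → List ℕ → AF → Set
nbhdAF (Q , _) V (Q' , _) = ∀ x y → x ∈ V → y ∈ V → Q' x y ≡ Q x y

nbhdLF : LF → List ℕ → LF → Set
nbhdLF ((Q , _) , _) V ((Q' , _) , _) =
  ∀ x y → (x ∈ V ⊎ y ∈ V) → Q' x y ≡ Q x y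

-- Topology generated by a family of basic sets (the family is closed under
-- finite intersections at any common point, so it is a basis):
-- U is open iff every point of U has a basic neighbourhood inside U.
IsOpen : {X : Set} → (X → List ℕ → X → Set) → (X → Set) → Set
IsOpen {X} nbhd U = ∀ (p : X) → U p → ∃[ V ] (∀ q → nbhd p V q → U q)

IsDense : {X : Set} → (X → List ℕ → X → Set) → (X → Set) → Set₁
IsDense {X} nbhd D =
  ∀ (U : X → Set) → IsOpen nbhd U → (∃[ p ] U p) → ∃[ p ] (U p × D p)

-- Ω_S : quivers having vertices i, j with Q(i,j) ∈ S  (S ⊆ ℤ_{≥0}, given
-- as a predicate on ℕ, viewed inside ℤ via +_)
ΩAF : (ℕ → Set) → AF → Set
ΩAF S (Q , _) = ∃[ i ] ∃[ j ] ∃[ s ] (S s × Q i j ≡ + s)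

ΩLF : (ℕ → Set) → LF → Set
ΩLF S (P , _) = ΩAF S P

module Submission where

-- Ω_S is open because membership is witnessed by one entry Q(i,j), and a basic
-- neighbourhood of {i} (in LF) or {i,j} (in AF) pins that entry down. It is
-- dense because inside the basic neighbourhood of Q given by a finite V we may
-- take a vertex m beyond V and overwrite Q(m,m+1) = s, Q(m+1,m) = -s for some
-- s ∈ S: no entry touching V changes, and each row changes in at most one
-- entry, so local finiteness is preserved.

open import Defs
open import Data.Integer using (ℤ; +_; -_; ∣_∣)
open import Data.Integer.Properties using (neg-involutive)
open import Data.List using (List; []; _∷_; [_])
open import Data.List.Extrema.Nat using (max; xs≤max)
open import Data.List.Membership.Propositional using (_∈_)
open import Data.List.Relation.Unary.All as All using ()
open import Data.List.Relation.Unary.Any using (here; there)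
open import Data.Nat using (ℕ; zero; suc; _+_; _≤_; _<_; z≤n; s≤s)
open import Data.Nat.Properties
  using (_≟_; <⇒≢; m<n⇒m<1+n; n<1+n; m≤m+n; ≤-trans; +-monoˡ-≤; +-commutativeSemigroup;
         module ≤-Reasoning)
open import Algebra.Properties.CommutativeSemigroup +-commutativeSemigroup using (xy∙z≈xz∙y)
open import Data.Product using (∃-syntax; _×_; _,_; proj₁)
open import Data.Product.Properties using (≡-dec; ,-injectiveˡ; ,-injectiveʳ)
open import Data.Sum using (_⊎_; inj₁; inj₂) renaming (map to ⊎-map)
open import Function using (_∘_)
open import Relation.Binary.Definitions using (DecidableEquality)
open import Relation.Binary.PropositionalEquality using (_≡_; _≢_; refl; sym; trans; cong; cong₂)
open import Relation.Nullary using (Dec; yes; no; contradiction)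

freshFor : List ℕ → ℕ
freshFor V = suc (max 0 V)

∈⇒<freshFor : ∀ {x V} → x ∈ V → x < freshFor V
∈⇒<freshFor {V = V} x∈V = s≤s (All.lookup (xs≤max 0 V) x∈V)

_≟²_ : DecidableEquality (ℕ × ℕ)
_≟²_ = ≡-dec _≟_ _≟_

withArrows : (ℕ → ℕ → ℤ) → ℕ → ℤ → ℕ → ℕ → ℤ
withArrows Q m k x y with (x , y) ≟² (m , suc m) | (y , x) ≟² (m , suc m)
... | yes _ | _     = k
... | no _  | yes _ = - k
... | no _  | no _  = Q x y

module _ {Q : ℕ → ℕ → ℤ} (m : ℕ) (k : ℤ) where

  withArrows-isQuiver : IsQuiver Q → IsQuiver (withArrows Q m k)
  withArrows-isQuiver skew x y with (x , y) ≟² (m , suc m) | (y , x) ≟² (m , suc m)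
  ... | yes refl | yes ()
  ... | yes refl | no _  = sym (neg-involutive k)
  ... | no _     | yes _ = refl
  ... | no _     | no _  = skew x y

  withArrows-at : withArrows Q m k m (suc m) ≡ k
  withArrows-at with (m , suc m) ≟² (m , suc m)
  ... | yes _  = refl
  ... | no m≢m = contradiction refl m≢m

  withArrows-away : ∀ {x y} → (x , y) ≢ (m , suc m) → (y , x) ≢ (m , suc m) →
                    withArrows Q m k x y ≡ Q x y
  withArrows-away {x} {y} xy≢ yx≢ with (x , y) ≟² (m , suc m) | (y , x) ≟² (m , suc m)
  ... | yes xy≡ | _       = contradiction xy≡ xy≢
  ... | no _    | yes yx≡ = contradiction yx≡ yx≢
  ... | no _    | no _    = refl

  withArrows-below : ∀ {x y} → x < m ⊎ y < m → withArrows Q m k x y ≡ Q x y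
  withArrows-below (inj₁ x<m) =
    withArrows-away (<⇒≢ x<m ∘ ,-injectiveˡ) (<⇒≢ (m<n⇒m<1+n x<m) ∘ ,-injectiveʳ)
  withArrows-below (inj₂ y<m) =
    withArrows-away (<⇒≢ (m<n⇒m<1+n y<m) ∘ ,-injectiveʳ) (<⇒≢ y<m ∘ ,-injectiveˡ)

RowwiseAlmostEqual : (ℕ → ℕ → ℤ) → (ℕ → ℕ → ℤ) → Set
RowwiseAlmostEqual A B = ∀ x → ∃[ y₀ ] (∀ y → y ≢ y₀ → A x y ≡ B x y)

withArrows-rowwiseAlmostEqual : ∀ {Q} m k → RowwiseAlmostEqual (withArrows Q m k) Q
withArrows-rowwiseAlmostEqual {Q} m k x = exceptional (x ≟ m)
  where
  exceptional : Dec (x ≡ m) → ∃[ y₀ ] (∀ y → y ≢ y₀ → withArrows Q m k x y ≡ Q x y)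
  exceptional (yes x≡m) = suc m , λ y y≢1+m →
    withArrows-away m k (y≢1+m ∘ ,-injectiveʳ) (<⇒≢ (n<1+n m) ∘ trans (sym x≡m) ∘ ,-injectiveʳ)
  exceptional (no x≢m) = m , λ y y≢m →
    withArrows-away m k (x≢m ∘ ,-injectiveˡ) (y≢m ∘ ,-injectiveˡ)

module _ {A B : ℕ → ℕ → ℤ} {x : ℕ} where

  partialAbsSum-cong : ∀ k → (∀ y → y < k → A x y ≡ B x y) →
                       partialAbsSum A x k ≡ partialAbsSum B x k
  partialAbsSum-cong zero    _  = refl
  partialAbsSum-cong (suc k) eq =
    cong₂ _+_ (partialAbsSum-cong k (λ y → eq y ∘ m<n⇒m<1+n)) (cong ∣_∣ (eq k (n<1+n k)))

  partialAbsSum-≤-except : ∀ {y₀} k → (∀ y → y ≢ y₀ → A x y ≡ B x y) →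
                           partialAbsSum A x k ≤ partialAbsSum B x k + ∣ A x y₀ ∣
  partialAbsSum-≤-except zero _ = z≤n
  partialAbsSum-≤-except {y₀} (suc k) eq with k ≟ y₀
  ... | yes refl = begin
    partialAbsSum A x k + ∣ A x k ∣
      ≡⟨ cong (_+ ∣ A x k ∣) (partialAbsSum-cong k (λ y → eq y ∘ <⇒≢)) ⟩
    partialAbsSum B x k + ∣ A x k ∣
      ≤⟨ +-monoˡ-≤ ∣ A x k ∣ (m≤m+n (partialAbsSum B x k) ∣ B x k ∣) ⟩
    partialAbsSum B x k + ∣ B x k ∣ + ∣ A x k ∣ ∎
    where open ≤-Reasoning
  ... | no k≢y₀ = begin
    partialAbsSum A x k + ∣ A x k ∣
      ≡⟨ cong (λ a → partialAbsSum A x k + ∣ a ∣) (eq k k≢y₀) ⟩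
    partialAbsSum A x k + ∣ B x k ∣
      ≤⟨ +-monoˡ-≤ ∣ B x k ∣ (partialAbsSum-≤-except k eq) ⟩
    partialAbsSum B x k + ∣ A x y₀ ∣ + ∣ B x k ∣
      ≡⟨ xy∙z≈xz∙y (partialAbsSum B x k) ∣ A x y₀ ∣ ∣ B x k ∣ ⟩
    partialAbsSum B x k + ∣ B x k ∣ + ∣ A x y₀ ∣ ∎
    where open ≤-Reasoning

locallyFinite-rowwiseAlmostEqual : ∀ {P P′ : Quiver} →
                                   RowwiseAlmostEqual (proj₁ P′) (proj₁ P) →
                                   LocallyFinite P → LocallyFinite P′
locallyFinite-rowwiseAlmostEqual {P′ = Q′ , _} P′≈P finite x =
  let (y₀ , eq) = P′≈P x
      (b , bound) = finite x
  in b + ∣ Q′ x y₀ ∣ , λ k → ≤-trans (partialAbsSum-≤-except k eq) (+-monoˡ-≤ ∣ Q′ x y₀ ∣ (bound k))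

plantArrowsAF : ℕ → ℤ → AF → AF
plantArrowsAF m k (Q , skew) = withArrows Q m k , withArrows-isQuiver m k skew

plantArrowsLF : ℕ → ℤ → LF → LF
plantArrowsLF m k (P , finite) =
  plantArrowsAF m k P ,
  locallyFinite-rowwiseAlmostEqual {P} {plantArrowsAF m k P} (withArrows-rowwiseAlmostEqual m k) finite

plantArrowsAF-nbhd : ∀ p V k → nbhdAF p V (plantArrowsAF (freshFor V) k p)
plantArrowsAF-nbhd _ V k _ _ x∈V _ = withArrows-below (freshFor V) k (inj₁ (∈⇒<freshFor x∈V))

plantArrowsLF-nbhd : ∀ p V k → nbhdLF p V (plantArrowsLF (freshFor V) k p)
plantArrowsLF-nbhd _ V k _ _ x∈V⊎y∈V =
  withArrows-below (freshFor V) k (⊎-map ∈⇒<freshFor ∈⇒<freshFor x∈V⊎y∈V)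

plantArrowsAF-∈Ω : ∀ {S s} → S s → ∀ m p → ΩAF S (plantArrowsAF m (+ s) p)
plantArrowsAF-∈Ω {s = s} s∈S m _ = m , suc m , s , s∈S , withArrows-at m (+ s)

dense-if-meets-basic : ∀ {X : Set} {nbhd : X → List ℕ → X → Set} {D : X → Set} →
                       (∀ p V → ∃[ q ] (nbhd p V q × D q)) → IsDense nbhd D
dense-if-meets-basic meets U U-open (p , p∈U) =
  let (V , V⊆U) = U-open p p∈U
      (q , q∈V , q∈D) = meets p V
  in q , V⊆U q q∈V , q∈D

module _ {S : ℕ → Set} where

  ΩAF-open : IsOpen nbhdAF (ΩAF S)
  ΩAF-open _ (i , j , s , s∈S , Qij≡s) =
    i ∷ j ∷ [] , λ _ q∼p → i , j , s , s∈S , trans (q∼p i j (here refl) (there (here refl))) Qij≡s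

  ΩLF-open : IsOpen nbhdLF (ΩLF S)
  ΩLF-open _ (i , j , s , s∈S , Qij≡s) =
    [ i ] , λ _ q∼p → i , j , s , s∈S , trans (q∼p i j (inj₁ (here refl))) Qij≡s

  ΩAF-dense : ∀ {s} → S s → IsDense nbhdAF (ΩAF S)
  ΩAF-dense {s} s∈S = dense-if-meets-basic λ p V →
    plantArrowsAF (freshFor V) (+ s) p , plantArrowsAF-nbhd p V (+ s) ,
    plantArrowsAF-∈Ω s∈S (freshFor V) p

  ΩLF-dense : ∀ {s} → S s → IsDense nbhdLF (ΩLF S)
  ΩLF-dense {s} s∈S = dense-if-meets-basic λ (p , finite) V →
    plantArrowsLF (freshFor V) (+ s) (p , finite) , plantArrowsLF-nbhd (p , finite) V (+ s) ,
    plantArrowsAF-∈Ω s∈S (freshFor V) p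

proposition4p24 : (S : ℕ → Set) → ∃[ s ] S s →
    (IsDense nbhdLF (ΩLF S) × IsOpen nbhdLF (ΩLF S))
    × (IsDense nbhdAF (ΩAF S) × IsOpen nbhdAF (ΩAF S))
proposition4p24 S (_ , s∈S) = (ΩLF-dense s∈S , ΩLF-open) , (ΩAF-dense s∈S , ΩAF-open)
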